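{- Let $\alpha>1$ and $0<\gamma<1$. Let $G=(V,W,E)$ be an $(\alpha,\gamma)$-single-neighbor $(\ell\times m)$-layered expander with partitions $V=V_0\uplus\dots\uplus V_\ell$ and $W=W_1\uplus\dots\uplus W_\ell$ such that $\deg(w)\le d$ for all $w\in W$, and suppose $d\le k\le\frac12\gamma m$. Let $x_\ell\in V_\ell$ and let $\beta_\ell\colon\{x_\ell\}\to\{0,1\}$ be given by $\beta_\ell(x_\ell)=1$. Let $\mathcal C:=\mathcal C_G\cup\{(\{x\},0)\mid x\in V_0\}$ and $r:=\lfloor \ell/(2k)\rfloor$. Then Verifier wins the $(r-1)$-round $k$-pebble game $\mathcal G^{r-1}_k(V,\mathcal C,\beta_\ell)$.
   Context: An $(\ell\times m)$-layered graph is a bipartite graph $G=(V,W,E)$ with partitions $V=V_0\uplus\dots\uplus V_\ell$, $W=W_1\uplus\dots\uplus W_\ell$ such that $|V_i|=|W_j|=m$, $N_G(W_i)\subseteq V_{i-1}\cup V_i$, and $G[V_i\cup W_i]$ is 1-regular for all $i\in[\ell]$. For $Y\subseteq W$, $N(Y)$ is the set of neighbors of $Y$ and $N^*(Y)=\{v\in N(Y)\mid |N(v)\cap Y|=1\}$. $G$ is an $(\alpha,\gamma)$-single-neighbor $(\ell\times m)$-layered expander if every nonempty $Y\subseteq W$ with $|Y|\le\gamma m$ satisfies $|N^*(Y)|\ge\alpha|Y|$. $\mathcal C_G:=\{(N(w),0)\mid w\in W\}$, a set of XOR-constraints over $V$. A partial assignment $\beta\colon X\to\{0,1\}$ violates an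 XOR-constraint $(C,a)$ if $C\subseteq X$ and $\sum_{x\in C}\beta(x)\not\equiv a\pmod 2$. In the $r'$-round $k$-pebble game $\mathcal G^{r'}_k(V,\mathcal C,\beta_0)$, starting at $\beta_0$, in each round at position $\beta\colon X\to\{0,1\}$ Falsifier picks $x\in V\setminus X$ and $X'\subseteq X$ with $|X'\cup\{x\}|\le k$, Verifier picks $b\in\{0,1\}$, and the position becomes $\beta'$ on $X'\cup\{x\}$ with $\beta'|_{X'}=\beta|_{X'}$, $\beta'(x)=b$. Falsifier wins a play if within the first $r'$ rounds some position (including the initial one) violates a constraint of $\mathcal C$; otherwise Verifier wins. Winning the game means having a winning strategy.
   Formalization: The parameters α and γ of the single-neighbor layered expander range over the rationals. -}

module Defs where

open import Data.Nat using (ℕ; zero; suc; _+_; _*_; _≤_; _<_)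
open import Data.Bool using (Bool; true; false; if_then_else_; _∧_; _xor_; not)
open import Data.Fin using (Fin; zero; suc; inject₁; fromℕ)
open import Data.Maybe using (Maybe; just; nothing)
open import Data.Product using (Σ; _×_; _,_; proj₁; proj₂; ∃-syntax)
open import Data.Product.Properties using (≡-dec)
open import Data.Sum using (_⊎_)
open import Data.Unit using (⊤)
import Data.Fin as Fin
open import Relation.Nullary using (¬_; Dec; yes; no)
open import Relation.Binary.PropositionalEquality using (_≡_; _≢_)
open import Data.Integer using (+_)
open import Data.Rational using (ℚ; _/_) renaming (_≤_ to _≤ℚ_; _<_ to _<ℚ_; _*_ to _*ℚ_)

count : ∀ {n} → (Fin n → Bool) → ℕ
count {zero}  f = 0
count {suc n} f = (if f zero then 1 else 0) + count (λ i → f (suc i))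

parity : ∀ {n} → (Fin n → Bool) → Bool
parity {zero}  f = false
parity {suc n} f = f zero xor parity (λ i → f (suc i))

count² : ∀ {a b} → (Fin a × Fin b → Bool) → ℕ
count² {zero}  f = 0
count² {suc a} f = count (λ j → f (zero , j)) + count² (λ p → f (suc (proj₁ p) , proj₂ p))

parity² : ∀ {a b} → (Fin a × Fin b → Bool) → Bool
parity² {zero}  f = false
parity² {suc a} f = parity (λ j → f (zero , j)) xor parity² (λ p → f (suc (proj₁ p) , proj₂ p))

ℕ→ℚ : ℕ → ℚ
ℕ→ℚ n = (+ n) / 1

-- V = V₀ ⊎ … ⊎ V_ℓ is modelled as Fin (suc ℓ) × Fin m  (layer, index);
-- W = W₁ ⊎ … ⊎ W_ℓ is modelled as Fin ℓ × Fin m, where layer j : Fin ℓ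
-- stands for W_{j+1}.

VSet : ℕ → ℕ → Set
VSet ℓ m = Fin (suc ℓ) × Fin m

WSet : ℕ → ℕ → Set
WSet ℓ m = Fin ℓ × Fin m

Edges : ℕ → ℕ → Set
Edges ℓ m = VSet ℓ m → WSet ℓ m → Bool

record IsLayered (ℓ m : ℕ) (E : Edges ℓ m) : Set where
  field
    -- N(W_{j+1}) ⊆ V_j ∪ V_{j+1}
    nbr-layers : ∀ (v : VSet ℓ m) (w : WSet ℓ m) → E v w ≡ true →
                 (proj₁ v ≡ inject₁ (proj₁ w)) ⊎ (proj₁ v ≡ suc (proj₁ w))
    -- G[V_{j+1} ∪ W_{j+1}] is 1-regular
    regular-W : ∀ (w : WSet ℓ m) →
                count (λ i → E (suc (proj₁ w) , i) w) ≡ 1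
    regular-V : ∀ (j : Fin ℓ) (i : Fin m) →
                count (λ i' → E (suc j , i) (j , i')) ≡ 1

∣_∣W : ∀ {ℓ m} → (WSet ℓ m → Bool) → ℕ
∣ Y ∣W = count² Y

nbrsIn : ∀ {ℓ m} → Edges ℓ m → (WSet ℓ m → Bool) → VSet ℓ m → ℕ
nbrsIn E Y v = count² (λ w → Y w ∧ E v w)

isOne : ℕ → Bool
isOne 1 = true
isOne _ = false

∣N*∣ : ∀ {ℓ m} → Edges ℓ m → (WSet ℓ m → Bool) → ℕ
∣N*∣ E Y = count² (λ v → isOne (nbrsIn E Y v))

IsSNExpander : (ℓ m : ℕ) → Edges ℓ m → ℚ → ℚ → Set
IsSNExpander ℓ m E α γ =
  ∀ (Y : WSet ℓ m → Bool) → 1 ≤ ∣ Y ∣W → ℕ→ℚ ∣ Y ∣W ≤ℚ (γ *ℚ ℕ→ℚ m) →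
  (α *ℚ ℕ→ℚ ∣ Y ∣W) ≤ℚ ℕ→ℚ (∣N*∣ E Y)

deg : ∀ {ℓ m} → Edges ℓ m → WSet ℓ m → ℕ
deg E w = count² (λ v → E v w)

XorConstraint : ℕ → ℕ → Set
XorConstraint ℓ m = (VSet ℓ m → Bool) × Bool

PAssign : ℕ → ℕ → Set
PAssign ℓ m = VSet ℓ m → Maybe Bool

isTrue : Maybe Bool → Bool
isTrue (just true) = true
isTrue _           = false

Violates : ∀ {ℓ m} → PAssign ℓ m → XorConstraint ℓ m → Set
Violates β (C , a) =
  (∀ v → C v ≡ true → β v ≢ nothing) ×
  (parity² (λ v → C v ∧ isTrue (β v)) ≢ a)

_≟V_ : ∀ {ℓ m} → (u v : VSet ℓ m) → Dec (u ≡ v)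
_≟V_ = ≡-dec Fin._≟_ Fin._≟_

isYes : ∀ {A : Set} → Dec A → Bool
isYes (yes _) = true
isYes (no _)  = false

N : ∀ {ℓ m} → Edges ℓ m → WSet ℓ m → VSet ℓ m → Bool
N E w v = E v w

singleton : ∀ {ℓ m} → VSet ℓ m → VSet ℓ m → Bool
singleton x v = isYes (x ≟V v)

InC : ∀ {ℓ m} → Edges ℓ m → XorConstraint ℓ m → Set
InC {ℓ} {m} E c =
  (Σ (WSet ℓ m) λ w → c ≡ (N E w , false)) ⊎
  (Σ (Fin m) λ i → c ≡ (singleton (zero , i) , false))

ViolatesSome : ∀ {ℓ m} → Edges ℓ m → PAssign ℓ m → Set
ViolatesSome E β = Σ _ λ c → InC E c × Violates β c

-- The k-pebble game.
-- New position after Falsifier picks x ∉ X and X' ⊆ X, and Verifier b.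
move : ∀ {ℓ m} → PAssign ℓ m → VSet ℓ m → (VSet ℓ m → Bool) → Bool → PAssign ℓ m
move β x X' b v with x ≟V v
... | yes _ = just b
... | no  _ = if X' v then β v else nothing

-- SafeFor n k E β : Verifier has a strategy from position β such that none of
-- the next n positions (the current one included) violates a constraint
-- of 𝒞.  Thus Verifier wins the r'-round game 𝒢^{r'}_k from β iff
-- SafeFor (r' + 1) k E β; the (r-1)-round game is SafeFor r.
SafeFor : ∀ {ℓ m} → ℕ → ℕ → Edges ℓ m → PAssign ℓ m → Set
SafeFor zero    k E β = ⊤
SafeFor {ℓ} {m} (suc n) k E β =
  ¬ ViolatesSome E β ×
  (∀ (x : VSet ℓ m) (X' : VSet ℓ m → Bool) →
     β x ≡ nothing →
     (∀ v → X' v ≡ true → β v ≢ nothing) →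
     count² X' + 1 ≤ k →
     Σ Bool λ b → SafeFor n k E (move β x X' b))

pointAssign : ∀ {ℓ m} → VSet ℓ m → PAssign ℓ m
pointAssign x v with x ≟V v
... | yes _ = just true
... | no  _ = nothing

-- Verifier keeps a frontier c: every pebbled vertex in a layer ≤ c carries 0, and there is no
-- refutation, i.e. no set Z of at most s = 2k − 1 constraints in layers ≥ c whose XOR, a constraint
-- on the boundary ∂Z, is violated once the unpebbled vertices of layers ≤ c are read as 0. A violated
-- constraint of 𝒞 would be a one-element refutation or would only see zeros, so the invariant keeps
-- Verifier alive. When Falsifier pebbles x in layer L, Verifier answers 0 if L ≤ c. Otherwise she
-- lowers the frontier to min(c, L − s − 1), losing at most s layers, and answers b so that no
-- refutation appears. A refutation of an answer has at most s constraints, so one of the s + 1 rows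
-- of constraints between the frontier and L is empty; the part below that row does not see x and
-- cannot refute the old position, so the part B above it is a refutation whose boundary is entirely
-- pebbled. Single-neighbour expansion gives |B| < |N*(B)| ≤ |∂B| ≤ k. If both answers were refuted,
-- x lies on the boundary of both parts B₀ and B₁ (otherwise that part refutes the old position), and
-- B₀ ⊕ B₁, of size at most 2k − 2 ≤ s, refutes the old position. Starting from the frontier
-- (r − 1)·s, more than s layers below x_ℓ, the invariant survives r − 1 rounds.

module Submission where

open import Defs
open import Algebra.Bundles using (CommutativeRing)
import Algebra.Properties.CommutativeSemigroup as CommSemigroupProperties
open import Data.Bool using (Bool; true; false; _∧_; _∨_; _xor_; not; if_then_else_)
open import Data.Bool.Properties using (xor-∧-commutativeRing; not-distribˡ-xor; ∧-distribʳ-xor)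
import Data.Bool.Properties as Boolₚ
open import Data.Empty using (⊥; ⊥-elim)
open import Data.Fin as Fin using (Fin; zero; suc; toℕ; fromℕ; combine; remQuot)
open import Data.Fin.Properties
  using (suc-injective; all?; remQuot-combine; toℕ-inject₁; toℕ-injective; toℕ<n; toℕ-fromℕ)
open import Data.Fin.Subset.Properties using (anySubset?)
open import Data.Integer as ℤ using (+_)
import Data.Integer.Properties as ℤₚ
open import Data.Maybe using (Maybe; just; nothing; is-just)
open import Data.Nat using (ℕ; zero; suc; _+_; _*_; _≤_; _<_; z≤n; s≤s; _≤?_; _<?_)
open import Data.Nat.Coprimality using (1-coprimeTo) renaming (sym to coprime-sym)
open import Data.Nat.Properties as ℕₚ
  using (≤-trans; ≤-reflexive; m≤n+m; m≤m+n; +-mono-≤; +-monoʳ-≤; n≤1+n; +-suc; <⇒≱; ≰⇒>;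
         <-≤-trans; ≤-<-trans)
open import Data.Product using (Σ; ∃; _×_; _,_; proj₁; proj₂; ∃-syntax)
open import Data.Product.Properties using (≡-dec)
open import Data.Rational using (ℚ; mkℚ; 0ℚ; 1ℚ) renaming (_*_ to _*ℚ_; _≤_ to _≤ℚ_; _<_ to _<ℚ_)
open import Data.Rational.Base using (*≤*; *<*; Positive)
import Data.Rational.Properties as ℚₚ
open import Data.Sum using (_⊎_; inj₁; inj₂)
open import Data.Unit using (tt)
open import Data.Vec using (lookup; tabulate)
open import Data.Vec.Properties using (lookup∘tabulate)
open import Function using (_∘_; case_of_)
open import Relation.Binary.PropositionalEquality
open import Relation.Nullary using (¬_; Dec; yes; no)
open import Relation.Nullary.Decidable using (map′; _×-dec_; _⊎-dec_; _→-dec_)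

-- Counting and parity over Fin n and Fin a × Fin b

private
  variable
    n a b : ℕ

_⊆_ : {A : Set} → (A → Bool) → (A → Bool) → Set
f ⊆ g = ∀ x → f x ≡ true → g x ≡ true

first : {A : Fin (suc a) × Fin b → Set} → (∀ p → A p) → ∀ j → A (zero , j)
first f j = f (zero , j)

rest : {A : Fin (suc a) × Fin b → Set} → (∀ p → A p) → ∀ p → A (suc (proj₁ p) , proj₂ p)
rest f p = f (suc (proj₁ p) , proj₂ p)

off-support : {A : Set} {f : A → Bool} {q : A} → (∀ x → f x ≡ true → x ≡ q) →
              ∀ x → x ≢ q → f x ≡ false
off-support {f = f} supp x x≢q with f x in fx
... | true  = ⊥-elim (x≢q (supp x fx))
... | false = refl

isOdd : ℕ → Bool
isOdd zero    = false
isOdd (suc n) = not (isOdd n)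

isOdd-+ : ∀ m n → isOdd (m + n) ≡ isOdd m xor isOdd n
isOdd-+ zero    n = refl
isOdd-+ (suc m) n = trans (cong not (isOdd-+ m n)) (not-distribˡ-xor (isOdd m) (isOdd n))

xor-interchange : ∀ w x y z → (w xor x) xor (y xor z) ≡ (w xor y) xor (x xor z)
xor-interchange = CommSemigroupProperties.interchange (CommutativeRing.+-commutativeSemigroup xor-∧-commutativeRing)

+-interchange : ∀ w x y z → (w + x) + (y + z) ≡ (w + y) + (x + z)
+-interchange = CommSemigroupProperties.interchange ℕₚ.+-commutativeSemigroup

count-cong : {f g : Fin n → Bool} → f ≗ g → count f ≡ count g
count-cong {zero}  f≗g = refl
count-cong {suc n} f≗g = cong₂ (λ b c → (if b then 1 else 0) + c) (f≗g zero) (count-cong (f≗g ∘ suc))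

count-mono : {f g : Fin n → Bool} → f ⊆ g → count f ≤ count g
count-mono {zero} f⊆g = z≤n
count-mono {suc n} {f} {g} f⊆g with f zero in f0
... | true rewrite f⊆g zero f0 = s≤s (count-mono (f⊆g ∘ suc))
... | false = ≤-trans (count-mono (f⊆g ∘ suc)) (m≤n+m _ _)

count-∨ : (f g : Fin n → Bool) → count (λ i → f i ∨ g i) ≤ count f + count g
count-∨ {zero}  f g = z≤n
count-∨ {suc n} f g with f zero | g zero
... | true  | true  = s≤s (≤-trans (count-∨ (f ∘ suc) (g ∘ suc)) (+-monoʳ-≤ (count (f ∘ suc)) (n≤1+n _)))
... | true  | false = s≤s (count-∨ (f ∘ suc) (g ∘ suc))
... | false | true  = ≤-trans (s≤s (count-∨ (f ∘ suc) (g ∘ suc))) (≤-reflexive (sym (+-suc _ _)))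
... | false | false = count-∨ (f ∘ suc) (g ∘ suc)

count-pos : (f : Fin n → Bool) (i : Fin n) → f i ≡ true → 1 ≤ count f
count-pos f zero    fi rewrite fi = s≤s z≤n
count-pos f (suc i) fi = ≤-trans (count-pos (f ∘ suc) i fi) (m≤n+m _ _)

count-witness : (f : Fin n → Bool) → 1 ≤ count f → ∃[ i ] f i ≡ true
count-witness {suc n} f 1≤c with f zero in f0
... | true  = zero , f0
... | false = let i , fi = count-witness (f ∘ suc) 1≤c in suc i , fi

count-false : (f : Fin n → Bool) → (∀ i → f i ≡ false) → count f ≡ 0
count-false {zero}  f f≡false = refl
count-false {suc n} f f≡false rewrite f≡false zero = count-false (f ∘ suc) (f≡false ∘ suc)

count≡0⇒false : (f : Fin n → Bool) → count f ≡ 0 → ∀ i → f i ≡ false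
count≡0⇒false f c≡0 i with f i in fi
... | false = refl
... | true  with () ← subst (1 ≤_) c≡0 (count-pos f i fi)

count-≤1 : (f : Fin n → Bool) (q : Fin n) → (∀ i → f i ≡ true → i ≡ q) → count f ≤ 1
count-≤1 f zero supp rewrite count-false (f ∘ suc) (λ i → off-support supp (suc i) λ ()) with f zero
... | true  = s≤s z≤n
... | false = z≤n
count-≤1 f (suc q) supp rewrite off-support supp zero (λ ()) =
  count-≤1 (f ∘ suc) q (λ i fi → suc-injective (supp (suc i) fi))

parity-cong : {f g : Fin n → Bool} → f ≗ g → parity f ≡ parity g
parity-cong {zero}  f≗g = refl
parity-cong {suc n} f≗g = cong₂ _xor_ (f≗g zero) (parity-cong (f≗g ∘ suc))

parity-xor : (f g : Fin n → Bool) → parity (λ i → f i xor g i) ≡ parity f xor parity g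
parity-xor {zero}  f g = refl
parity-xor {suc n} f g rewrite parity-xor (f ∘ suc) (g ∘ suc) = xor-interchange (f zero) (g zero) _ _

parity-count : (f : Fin n → Bool) → parity f ≡ isOdd (count f)
parity-count {zero}  f = refl
parity-count {suc n} f rewrite isOdd-+ (if f zero then 1 else 0) (count (f ∘ suc)) | parity-count (f ∘ suc) with f zero
... | true  = refl
... | false = refl

count²-cong : {f g : Fin a × Fin b → Bool} → f ≗ g → count² f ≡ count² g
count²-cong {zero}  f≗g = refl
count²-cong {suc a} f≗g = cong₂ _+_ (count-cong (first f≗g)) (count²-cong (rest f≗g))

count²-mono : {f g : Fin a × Fin b → Bool} → f ⊆ g → count² f ≤ count² g
count²-mono {zero}  f⊆g = z≤n
count²-mono {suc a} f⊆g = +-mono-≤ (count-mono (first f⊆g)) (count²-mono (rest f⊆g))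

count²-∨ : (f g : Fin a × Fin b → Bool) → count² (λ p → f p ∨ g p) ≤ count² f + count² g
count²-∨ {zero}  f g = z≤n
count²-∨ {suc a} f g =
  ≤-trans (+-mono-≤ (count-∨ (first f) (first g)) (count²-∨ (rest f) (rest g)))
          (≤-reflexive (+-interchange (count (first f)) (count (first g)) (count² (rest f)) (count² (rest g))))

count²-pos : (f : Fin a × Fin b → Bool) (p : Fin a × Fin b) → f p ≡ true → 1 ≤ count² f
count²-pos f (zero  , j) fp = ≤-trans (count-pos (first f) j fp) (m≤m+n _ _)
count²-pos f (suc i , j) fp = ≤-trans (count²-pos (rest f) (i , j) fp) (m≤n+m _ _)

count²-witness : (f : Fin a × Fin b → Bool) → 1 ≤ count² f → ∃[ p ] f p ≡ true
count²-witness {suc a} f 1≤c with count (first f) in c₀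
... | suc _ = let j , fj = count-witness (first f) (subst (1 ≤_) (sym c₀) (s≤s z≤n)) in (zero , j) , fj
... | zero  = let (i , j) , fp = count²-witness (rest f) 1≤c in (suc i , j) , fp

count²-false : (f : Fin a × Fin b → Bool) → (∀ p → f p ≡ false) → count² f ≡ 0
count²-false {zero}  f f≡false = refl
count²-false {suc a} f f≡false =
  cong₂ _+_ (count-false (first f) (first f≡false)) (count²-false (rest f) (rest f≡false))

count²-≤1 : (f : Fin a × Fin b → Bool) (q : Fin a × Fin b) → (∀ p → f p ≡ true → p ≡ q) → count² f ≤ 1
count²-≤1 f (zero , j) supp
  rewrite count²-false (rest f) (λ p → off-support supp (suc (proj₁ p) , proj₂ p) λ ())
        | ℕₚ.+-identityʳ (count (first f))
  = count-≤1 (first f) j (λ i fi → cong proj₂ (supp (zero , i) fi))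
count²-≤1 f (suc i , j) supp
  rewrite count-false (first f) (λ j′ → off-support supp (zero , j′) λ ())
  = count²-≤1 (rest f) (i , j) (λ p fp → rest-injective (supp (suc (proj₁ p) , proj₂ p) fp))
  where
  rest-injective : ∀ {p q : Fin a × Fin b} →
                   (Fin.suc (proj₁ p) , proj₂ p) ≡ (suc (proj₁ q) , proj₂ q) → p ≡ q
  rest-injective refl = refl

parity²-cong : {f g : Fin a × Fin b → Bool} → f ≗ g → parity² f ≡ parity² g
parity²-cong {zero}  f≗g = refl
parity²-cong {suc a} f≗g = cong₂ _xor_ (parity-cong (first f≗g)) (parity²-cong (rest f≗g))

parity²-xor : (f g : Fin a × Fin b → Bool) → parity² (λ p → f p xor g p) ≡ parity² f xor parity² g
parity²-xor {zero}  f g = refl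
parity²-xor {suc a} f g rewrite parity-xor (first f) (first g) | parity²-xor (rest f) (rest g) =
  xor-interchange (parity (first f)) (parity (first g)) (parity² (rest f)) (parity² (rest g))

parity²-count : (f : Fin a × Fin b → Bool) → parity² f ≡ isOdd (count² f)
parity²-count {zero}  f = refl
parity²-count {suc a} f rewrite isOdd-+ (count (first f)) (count² (rest f))
  = cong₂ _xor_ (parity-count (first f)) (parity²-count (rest f))

parity²-false : (f : Fin a × Fin b → Bool) → (∀ p → f p ≡ false) → parity² f ≡ false
parity²-false f f≡false = trans (parity²-count f) (cong isOdd (count²-false f f≡false))

parity²-witness : (f : Fin a × Fin b → Bool) → parity² f ≡ true → ∃[ p ] f p ≡ true
parity²-witness f odd = count²-witness f (odd⇒pos (count² f) (trans (sym (parity²-count f)) odd))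
  where
  odd⇒pos : ∀ n → isOdd n ≡ true → 1 ≤ n
  odd⇒pos (suc n) _ = s≤s z≤n

parity²-point : (f : Fin a × Fin b → Bool) (q : Fin a × Fin b) → (∀ p → f p ≡ true → p ≡ q) →
                parity² f ≡ f q
parity²-point f q supp with f q in fq
... | true  = trans (parity²-count f) (cong isOdd (ℕₚ.≤-antisym (count²-≤1 f q supp) (count²-pos f q fq)))
... | false = parity²-false f vanishes
  where
  vanishes : ∀ p → f p ≡ false
  vanishes p with f p in fp
  ... | false = refl
  ... | true  with refl ← supp p fp = trans (sym fp) fq

empty-row : (Z : Fin a × Fin b → Bool) (c L : ℕ) → L ≤ a → c + count² Z < L →
            ∃[ h ] c ≤ toℕ h × toℕ h < L × (∀ j → Z (h , j) ≡ false)
empty-row {suc a} Z zero (suc L) (s≤s L≤a) Z<L with count (first Z) in c₀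
... | zero  = zero , z≤n , s≤s z≤n , count≡0⇒false (first Z) c₀
... | suc _ =
  let h , _ , h<L , empty = empty-row (rest Z) zero L L≤a (≤-trans (s≤s (m≤n+m _ _)) (ℕₚ.≤-pred Z<L))
  in suc h , z≤n , s≤s h<L , empty
empty-row {suc a} Z (suc c) (suc L) (s≤s L≤a) Z<L =
  let h , c≤h , h<L , empty =
        empty-row (rest Z) c L L≤a (≤-trans (s≤s (+-monoʳ-≤ c (m≤n+m _ _))) (ℕₚ.≤-pred Z<L))
  in suc h , s≤s c≤h , s≤s h<L , empty

all²? : {P : Fin a × Fin b → Set} → (∀ p → Dec (P p)) → Dec (∀ p → P p)
all²? P? = map′ (λ h p → h (proj₁ p) (proj₂ p)) (λ h i j → h (i , j))
                (all? λ i → all? λ j → P? (i , j))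

any-subset²? : (P : (Fin a × Fin b → Bool) → Set) → (∀ Z → Dec (P Z)) →
               (∀ {Z Z′} → Z ≗ Z′ → P Z → P Z′) → Dec (∃ P)
any-subset²? {a} {b} P P? resp =
  map′ (λ (S , PS) → _ , PS)
       (λ (Z , PZ) → tabulate (Z ∘ remQuot b) , resp (λ (i , j) → sym (decode Z i j)) PZ)
       (anySubset? (λ S → P? (λ p → lookup S (combine (proj₁ p) (proj₂ p)))))
  where
  decode : ∀ (Z : Fin a × Fin b → Bool) i j →
           lookup (tabulate (Z ∘ remQuot b)) (combine i j) ≡ Z (i , j)
  decode Z i j = trans (lookup∘tabulate _ (combine i j)) (cong Z (remQuot-combine i j))

∧-true : ∀ {a b} → a ∧ b ≡ true → a ≡ true × b ≡ true
∧-true {true} {true} _ = refl , refl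

xor-true : ∀ {a b} → a xor b ≡ true → a ≡ true ⊎ b ≡ true
xor-true {true}  _ = inj₁ refl
xor-true {false} b = inj₂ b

isYes-true : ∀ {A : Set} (d : Dec A) → isYes d ≡ true → A
isYes-true (yes a) _ = a

isYes-refl : ∀ {A : Set} {x : A} (d : Dec (x ≡ x)) → isYes d ≡ true
isYes-refl (yes _) = refl
isYes-refl (no ¬p) = ⊥-elim (¬p refl)

-- Positions of the pebble game

dom : {A : Set} → (A → Maybe Bool) → A → Bool
dom β v = is-just (β v)

isTrue-just : ∀ b → isTrue (just b) ≡ b
isTrue-just true  = refl
isTrue-just false = refl

≢nothing⇒dom : ∀ {A : Set} {β : A → Maybe Bool} v → β v ≢ nothing → dom β v ≡ true
≢nothing⇒dom {β = β} v assigned with β v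
... | just _  = refl
... | nothing = ⊥-elim (assigned refl)

record Update {ℓ m} (β : PAssign ℓ m) (x : VSet ℓ m) (b : Bool) (β′ : PAssign ℓ m) : Set where
  field
    fresh   : β x ≡ nothing
    sets    : β′ x ≡ just b
    forgets : ∀ v → x ≢ v → β′ v ≡ β v ⊎ β′ v ≡ nothing

module _ {ℓ m} {β β′ : PAssign ℓ m} {x : VSet ℓ m} {b : Bool} (u : Update β x b β′) where
  open Update u

  update-agrees : ∀ v → x ≢ v → dom β′ v ≡ true → β′ v ≡ β v
  update-agrees v x≢v v∈β′ with forgets v x≢v
  ... | inj₁ same = same
  ... | inj₂ gone with () ← trans (sym (cong is-just gone)) v∈β′

  update-dom : ∀ v → dom β′ v ≡ true → x ≡ v ⊎ dom β v ≡ true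
  update-dom v v∈β′ with x ≟V v
  ... | yes x≡v = inj₁ x≡v
  ... | no  x≢v = inj₂ (trans (cong is-just (sym (update-agrees v x≢v v∈β′))) v∈β′)

  update-ones : ∀ v → isTrue (β′ v) ≡ true → (x ≡ v × b ≡ true) ⊎ isTrue (β v) ≡ true
  update-ones v one with x ≟V v
  ... | yes refl = inj₁ (refl , trans (sym (trans (cong isTrue sets) (isTrue-just b))) one)
  ... | no  x≢v with forgets v x≢v
  ...   | inj₁ same = inj₂ (trans (cong isTrue (sym same)) one)
  ...   | inj₂ gone with () ← trans (sym (cong isTrue gone)) one

  update-isTrue : ∀ v → x ≢ v → dom β′ v ≡ true ⊎ isTrue (β v) ≡ false → isTrue (β′ v) ≡ isTrue (β v)
  update-isTrue v x≢v known with forgets v x≢v | known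
  ... | inj₁ same | _         = cong isTrue same
  ... | inj₂ gone | inj₁ v∈β′ with () ← trans (sym (cong is-just gone)) v∈β′
  ... | inj₂ gone | inj₂ β≡0 = trans (cong isTrue gone) (sym β≡0)

move-update : ∀ {ℓ m} {β : PAssign ℓ m} {x} X′ b → β x ≡ nothing → Update β x b (move β x X′ b)
move-update {β = β} {x} X′ b fresh = record { fresh = fresh ; sets = sets ; forgets = forgets }
  where
  sets : move β x X′ b x ≡ just b
  sets with x ≟V x
  ... | yes _   = refl
  ... | no  x≢x = ⊥-elim (x≢x refl)
  forgets : ∀ v → x ≢ v → move β x X′ b v ≡ β v ⊎ move β x X′ b v ≡ nothing
  forgets v x≢v with x ≟V v
  ... | yes x≡v = ⊥-elim (x≢v x≡v)
  ... | no  _ with X′ v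
  ...   | true  = inj₁ refl
  ...   | false = inj₂ refl

singleton-support : ∀ {ℓ m} (x v : VSet ℓ m) → singleton x v ≡ true → v ≡ x
singleton-support x v p = sym (isYes-true (x ≟V v) p)

count²-dom-move : ∀ {ℓ m} (β : PAssign ℓ m) x X′ b → count² (dom (move β x X′ b)) ≤ count² X′ + 1
count²-dom-move β x X′ b =
  ≤-trans (count²-mono dom⊆X′∪x)
          (≤-trans (count²-∨ X′ (singleton x))
                   (+-monoʳ-≤ (count² X′) (count²-≤1 (singleton x) x (singleton-support x))))
  where
  dom⊆X′∪x : dom (move β x X′ b) ⊆ (λ v → X′ v ∨ singleton x v)
  dom⊆X′∪x v v∈dom with x ≟V v
  ... | yes _ = Boolₚ.∨-zeroʳ (X′ v)
  ... | no  _ with X′ v | v∈dom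
  ...   | true  | _ = refl

pointAssign-update : ∀ {ℓ m} (x : VSet ℓ m) → Update (λ _ → nothing) x true (pointAssign x)
pointAssign-update x = record { fresh = refl ; sets = sets ; forgets = forgets }
  where
  sets : pointAssign x x ≡ just true
  sets with x ≟V x
  ... | yes _   = refl
  ... | no  x≢x = ⊥-elim (x≢x refl)
  forgets : ∀ v → x ≢ v → pointAssign x v ≡ nothing ⊎ pointAssign x v ≡ nothing
  forgets v x≢v with x ≟V v
  ... | yes x≡v = ⊥-elim (x≢v x≡v)
  ... | no  _   = inj₂ refl

count²-dom-pointAssign : ∀ {ℓ m} (x : VSet ℓ m) → count² (dom (pointAssign x)) ≤ 1
count²-dom-pointAssign x = count²-≤1 _ x support
  where
  support : ∀ v → dom (pointAssign x) v ≡ true → v ≡ x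
  support v p with x ≟V v
  ... | yes x≡v = sym x≡v

lower-frontier : ∀ {s c L} → s ≤ c → c < L → ∃[ c′ ] c′ ≤ c × c′ + s < L × c ≤ s + c′
lower-frontier {s} {c} {L} s≤c c<L with c + s <? L
... | yes c+s<L = c , ℕₚ.≤-refl , c+s<L , ℕₚ.m≤n+m c s
... | no  c+s≮L with ℕₚ.m≤n⇒∃[o]m+o≡n (ℕₚ.≤-<-trans s≤c c<L)
...   | c′ , 1+s+c′≡L = c′ , c′≤c , c′+s<L , ℕₚ.≤-pred (subst (c <_) (sym 1+s+c′≡L) c<L)
  where
  c′+s<L : c′ + s < L
  c′+s<L = ≤-reflexive (trans (cong suc (ℕₚ.+-comm c′ s)) 1+s+c′≡L)
  c′≤c : c′ ≤ c
  c′≤c = ℕₚ.+-cancelˡ-≤ s c′ c (ℕₚ.<⇒≤ (begin-strict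
    s + c′   <⟨ ≤-reflexive 1+s+c′≡L ⟩
    L        ≤⟨ ℕₚ.≮⇒≥ c+s≮L ⟩
    c + s    ≡⟨ ℕₚ.+-comm c s ⟩
    s + c    ∎))
    where open ℕₚ.≤-Reasoning

module Layered {ℓ m : ℕ} (E : Edges ℓ m) (layered : IsLayered ℓ m E) where

  V W : Set
  V = VSet ℓ m
  W = WSet ℓ m

  layerᵥ : V → ℕ
  layerᵥ v = toℕ (proj₁ v)

  layerʷ : W → ℕ
  layerʷ w = toℕ (proj₁ w)

  adjacent-layers : ∀ v w → E v w ≡ true → layerʷ w ≤ layerᵥ v × layerᵥ v ≤ suc (layerʷ w)
  adjacent-layers v w e with IsLayered.nbr-layers layered v w e
  ... | inj₁ v∈Vⱼ = ≤-reflexive (sym same) , ≤-trans (≤-reflexive same) (n≤1+n _)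
    where same = trans (cong toℕ v∈Vⱼ) (toℕ-inject₁ (proj₁ w))
  ... | inj₂ v∈Vⱼ₊₁ = ≤-trans (n≤1+n _) (≤-reflexive (sym same)) , ≤-reflexive same
    where same = cong toℕ v∈Vⱼ₊₁

  -- v lies on the boundary ∂ Z iff it occurs in an odd number of the constraints N(w), w ∈ Z;
  -- the XOR of these constraints is the constraint on ∂ Z.
  ∂ : (W → Bool) → V → Bool
  ∂ Z v = parity² (λ w → Z w ∧ E v w)

  ∂-cong : ∀ {Z Z′} → Z ≗ Z′ → ∀ v → ∂ Z v ≡ ∂ Z′ v
  ∂-cong Z≗Z′ v = parity²-cong (λ w → cong (_∧ E v w) (Z≗Z′ w))

  ∂-xor : ∀ Z Z′ v → ∂ (λ w → Z w xor Z′ w) v ≡ ∂ Z v xor ∂ Z′ v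
  ∂-xor Z Z′ v = trans (parity²-cong (λ w → ∧-distribʳ-xor (E v w) (Z w) (Z′ w)))
                       (parity²-xor (λ w → Z w ∧ E v w) (λ w → Z′ w ∧ E v w))

  ∂-witness : ∀ Z v → ∂ Z v ≡ true → ∃[ w ] Z w ≡ true × E v w ≡ true
  ∂-witness Z v odd = let w , Zw∧e = parity²-witness _ odd in w , ∧-true Zw∧e

  ∂-below : ∀ {Z} t → (∀ w → Z w ≡ true → layerʷ w < t) → ∀ v → ∂ Z v ≡ true → layerᵥ v ≤ t
  ∂-below t low v odd =
    let w , Zw , e = ∂-witness _ v odd in ≤-trans (proj₂ (adjacent-layers v w e)) (low w Zw)

  ∂-above : ∀ {Z} t → (∀ w → Z w ≡ true → t ≤ layerʷ w) → ∀ v → ∂ Z v ≡ true → t ≤ layerᵥ v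
  ∂-above t high v odd =
    let w , Zw , e = ∂-witness _ v odd in ≤-trans (high w Zw) (proj₁ (adjacent-layers v w e))

  nonempty-∂ : ∀ Z v → ∂ Z v ≡ true → 1 ≤ count² Z
  nonempty-∂ Z v odd = let w , Zw , _ = ∂-witness Z v odd in count²-pos Z w Zw

  single-neighbour⇒∂ : ∀ Z v → isOne (nbrsIn E Z v) ≡ true → ∂ Z v ≡ true
  single-neighbour⇒∂ Z v one = trans (parity²-count (λ w → Z w ∧ E v w)) (cong isOdd (isOne⇒≡1 _ one))
    where
    isOne⇒≡1 : ∀ n → isOne n ≡ true → n ≡ 1
    isOne⇒≡1 1 _ = refl

  pointʷ : W → W → Bool
  pointʷ w w′ = isYes (≡-dec Fin._≟_ Fin._≟_ w w′)

  pointʷ-support : ∀ w w′ → pointʷ w w′ ≡ true → w′ ≡ w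
  pointʷ-support w w′ p = sym (isYes-true (≡-dec Fin._≟_ Fin._≟_ w w′) p)

  ∂-pointʷ : ∀ w v → ∂ (pointʷ w) v ≡ E v w
  ∂-pointʷ w v = trans (parity²-point _ w (λ w′ p → pointʷ-support w w′ (proj₁ (∧-true p))))
                       (cong (_∧ E v w) (isYes-refl (≡-dec Fin._≟_ Fin._≟_ w w)))

  _↾≥_ _↾<_ : (W → Bool) → ℕ → W → Bool
  (Z ↾≥ t) w = Z w ∧ isYes (t ≤? layerʷ w)
  (Z ↾< t) w = Z w ∧ not (isYes (t ≤? layerʷ w))

  ↾≥-⊆ : ∀ Z t → (Z ↾≥ t) ⊆ Z
  ↾≥-⊆ Z t w p = proj₁ (∧-true p)

  ↾<-⊆ : ∀ Z t → (Z ↾< t) ⊆ Z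
  ↾<-⊆ Z t w p = proj₁ (∧-true p)

  ↾≥-layer : ∀ Z t w → (Z ↾≥ t) w ≡ true → t ≤ layerʷ w
  ↾≥-layer Z t w p with t ≤? layerʷ w | p
  ... | yes t≤ | _ = t≤
  ... | no  _  | p′ with () ← proj₂ (∧-true {Z w} p′)

  ↾<-layer : ∀ Z t w → (Z ↾< t) w ≡ true → layerʷ w < t
  ↾<-layer Z t w p with t ≤? layerʷ w | p
  ... | no  t≰ | _ = ≰⇒> t≰
  ... | yes _  | p′ with () ← proj₂ (∧-true {Z w} p′)

  ↾-xor : ∀ Z t → Z ≗ λ w → (Z ↾< t) w xor (Z ↾≥ t) w
  ↾-xor Z t w with Z w | t ≤? layerʷ w
  ... | true  | yes _ = refl
  ... | true  | no  _ = refl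
  ... | false | _     = refl

  ∂-↾ : ∀ Z t v → ∂ Z v ≡ ∂ (Z ↾< t) v xor ∂ (Z ↾≥ t) v
  ∂-↾ Z t v = trans (∂-cong (↾-xor Z t) v) (∂-xor _ _ v)

  ∂-sum : (W → Bool) → PAssign ℓ m → Bool
  ∂-sum Z β = parity² (λ v → ∂ Z v ∧ isTrue (β v))

  ∂-sum-cong : ∀ {Z Z′} → Z ≗ Z′ → ∀ β → ∂-sum Z β ≡ ∂-sum Z′ β
  ∂-sum-cong Z≗Z′ β = parity²-cong (λ v → cong (_∧ isTrue (β v)) (∂-cong Z≗Z′ v))

  ∂-sum-agree : ∀ Z {β β′ : PAssign ℓ m} → (∀ v → ∂ Z v ≡ true → isTrue (β v) ≡ isTrue (β′ v)) →
                ∂-sum Z β ≡ ∂-sum Z β′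
  ∂-sum-agree Z {β} {β′} agree = parity²-cong pointwise
    where
    pointwise : ∀ v → ∂ Z v ∧ isTrue (β v) ≡ ∂ Z v ∧ isTrue (β′ v)
    pointwise v with ∂ Z v in odd
    ... | true  = agree v odd
    ... | false = refl

  ∂-sum-xor : ∀ Z Z′ β → ∂-sum (λ w → Z w xor Z′ w) β ≡ ∂-sum Z β xor ∂-sum Z′ β
  ∂-sum-xor Z Z′ β =
    trans (parity²-cong λ v → trans (cong (_∧ isTrue (β v)) (∂-xor Z Z′ v))
                                    (∧-distribʳ-xor (isTrue (β v)) (∂ Z v) (∂ Z′ v)))
          (parity²-xor (λ v → ∂ Z v ∧ isTrue (β v)) (λ v → ∂ Z′ v ∧ isTrue (β v)))

  ∂-sum-↾ : ∀ Z t β → ∂-sum Z β ≡ ∂-sum (Z ↾< t) β xor ∂-sum (Z ↾≥ t) β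
  ∂-sum-↾ Z t β = trans (∂-sum-cong (↾-xor Z t) β) (∂-sum-xor (Z ↾< t) (Z ↾≥ t) β)

  ∂-sum-update : ∀ {β β′ x b} Z → Update β x b β′ → ∂ Z ⊆ dom β′ →
                 ∂-sum Z β ≡ ∂-sum Z β′ xor (∂ Z x ∧ b)
  ∂-sum-update {β} {β′} {x} {b} Z u ∂Z⊆dom = begin
    ∂-sum Z β                                 ≡⟨ parity²-cong pointwise ⟩
    parity² (λ v → (∂ Z v ∧ isTrue (β′ v)) xor flip v)
                                              ≡⟨ parity²-xor (λ v → ∂ Z v ∧ isTrue (β′ v)) flip ⟩
    ∂-sum Z β′ xor parity² flip               ≡⟨ cong (∂-sum Z β′ xor_) (parity²-point flip x flip-support) ⟩
    ∂-sum Z β′ xor flip x                     ≡⟨ cong (λ t → ∂-sum Z β′ xor (t ∧ (∂ Z x ∧ b)))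
                                                       (isYes-refl (x ≟V x)) ⟩
    ∂-sum Z β′ xor (∂ Z x ∧ b)                ∎
    where
    open ≡-Reasoning
    open Update u
    flip : VSet ℓ m → Bool
    flip v = singleton x v ∧ (∂ Z x ∧ b)
    flip-support : ∀ v → flip v ≡ true → v ≡ x
    flip-support v p = singleton-support x v (proj₁ (∧-true p))
    pointwise : ∀ v → ∂ Z v ∧ isTrue (β v) ≡ (∂ Z v ∧ isTrue (β′ v)) xor flip v
    pointwise v with x ≟V v
    ... | yes refl rewrite sets | fresh | isTrue-just b =
      trans (Boolₚ.∧-zeroʳ (∂ Z x)) (sym (Boolₚ.xor-same (∂ Z x ∧ b)))
    pointwise v | no x≢v with ∂ Z v in odd
    ... | true  = trans (sym (update-isTrue u v x≢v (inj₁ (∂Z⊆dom v odd)))) (sym (Boolₚ.xor-identityʳ _))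
    ... | false = refl

  -- Unpebbled vertices of ∂ Z are allowed only in layers ≤ c, where isTrue reads them as 0.
  record Refutation (s c : ℕ) (β : PAssign ℓ m) (Z : W → Bool) : Set where
    field
      above   : ∀ w → Z w ≡ true → c ≤ layerʷ w
      small   : count² Z ≤ s
      covered : ∀ v → ∂ Z v ≡ true → dom β v ≡ true ⊎ layerᵥ v ≤ c
      odd-sum : ∂-sum Z β ≡ true

  record Frontier (s c : ℕ) (β : PAssign ℓ m) : Set where
    field
      ones-above : ∀ v → isTrue (β v) ≡ true → c < layerᵥ v
      unrefuted  : ∀ Z → ¬ Refutation s c β Z

    zero-below : ∀ v → layerᵥ v ≤ c → isTrue (β v) ≡ false
    zero-below v v≤c = Boolₚ.¬-not (λ one → <⇒≱ (ones-above v one) v≤c)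

  open Refutation
  open Frontier

  refutation-⊆ : ∀ {s c β β′ Z Z′} → Z′ ⊆ Z → Refutation s c β Z →
                 (∀ v → ∂ Z′ v ≡ true → dom β′ v ≡ true ⊎ layerᵥ v ≤ c) →
                 ∂-sum Z′ β′ ≡ true → Refutation s c β′ Z′
  refutation-⊆ Z′⊆Z R covered′ odd′ = record
    { above = λ w Z′w → above R w (Z′⊆Z w Z′w)
    ; small = ≤-trans (count²-mono Z′⊆Z) (small R)
    ; covered = covered′
    ; odd-sum = odd′ }

  refutation-cong : ∀ {s c β Z Z′} → Z ≗ Z′ → Refutation s c β Z → Refutation s c β Z′
  refutation-cong {β = β} Z≗Z′ R = record
    { above = λ w Z′w → above R w (trans (Z≗Z′ w) Z′w)
    ; small = ≤-trans (≤-reflexive (count²-cong (sym ∘ Z≗Z′))) (small R)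
    ; covered = λ v odd → covered R v (trans (∂-cong Z≗Z′ v) odd)
    ; odd-sum = trans (sym (∂-sum-cong Z≗Z′ β)) (odd-sum R) }

  refutation? : ∀ s c β Z → Dec (Refutation s c β Z)
  refutation? s c β Z =
    map′ (λ (a , sm , cv , o) → record { above = a ; small = sm ; covered = cv ; odd-sum = o })
         (λ R → above R , small R , covered R , odd-sum R)
         (all²? (λ w → (Z w Boolₚ.≟ true) →-dec (c ≤? layerʷ w))
          ×-dec count² Z ≤? s
          ×-dec all²? (λ v → (∂ Z v Boolₚ.≟ true) →-dec ((dom β v Boolₚ.≟ true) ⊎-dec (layerᵥ v ≤? c)))
          ×-dec ∂-sum Z β Boolₚ.≟ true)

  ∃refutation? : ∀ s c β → Dec (∃ (Refutation s c β))
  ∃refutation? s c β = any-subset²? (Refutation s c β) (refutation? s c β) refutation-cong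

  refutation-nonempty : ∀ {s c β Z} → Refutation s c β Z → 1 ≤ count² Z
  refutation-nonempty {β = β} {Z} R =
    let v , p = parity²-witness (λ v → ∂ Z v ∧ isTrue (β v)) (odd-sum R) in nonempty-∂ Z v (proj₁ (∧-true p))

  ∂-↾≥-high : ∀ Z t v → t < layerᵥ v → ∂ (Z ↾≥ t) v ≡ ∂ Z v
  ∂-↾≥-high Z t v t<v = sym (trans (∂-↾ Z t v) (cong (_xor ∂ (Z ↾≥ t) v) low-part-vanishes))
    where
    low-part-vanishes : ∂ (Z ↾< t) v ≡ false
    low-part-vanishes = Boolₚ.¬-not (λ odd → <⇒≱ t<v (∂-below t (↾<-layer Z t) v odd))

  frontier-consistent : ∀ {s c β} → 1 ≤ s → Frontier s c β → ¬ ViolatesSome E β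
  frontier-consistent {c = c} {β} 1≤s F (_ , inj₁ (w , refl) , assigned , odd) with c ≤? layerʷ w
  ... | yes c≤w = unrefuted F (pointʷ w) record
    { above = λ w′ p → subst (λ w″ → c ≤ layerʷ w″) (sym (pointʷ-support w w′ p)) c≤w
    ; small = ≤-trans (count²-≤1 (pointʷ w) w (pointʷ-support w)) 1≤s
    ; covered = λ v p → inj₁ (≢nothing⇒dom {β = β} v (assigned v (trans (sym (∂-pointʷ w v)) p)))
    ; odd-sum = trans (parity²-cong (λ v → cong (_∧ isTrue (β v)) (∂-pointʷ w v))) (Boolₚ.¬-not odd) }
  ... | no  c≰w = odd (parity²-false _ vanishes)
    where
    vanishes : ∀ v → E v w ∧ isTrue (β v) ≡ false
    vanishes v with E v w in e
    ... | true  = zero-below F v (≤-trans (proj₂ (adjacent-layers v w e)) (≰⇒> c≰w))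
    ... | false = refl
  frontier-consistent {β = β} _ F (_ , inj₂ (i , refl) , _ , odd) = odd (parity²-false _ vanishes)
    where
    vanishes : ∀ v → singleton (zero , i) v ∧ isTrue (β v) ≡ false
    vanishes v with (zero , i) ≟V v
    ... | yes refl = zero-below F v z≤n
    ... | no  _    = refl

  frontier-empty : ∀ s c → Frontier s c (λ _ → nothing)
  frontier-empty s c = record
    { ones-above = λ v ()
    ; unrefuted = λ Z R → case trans (sym (odd-sum R)) (parity²-false _ (Boolₚ.∧-zeroʳ ∘ ∂ Z)) of λ () }

  frontier-lower : ∀ {s c c′ β} → c′ ≤ c → Frontier s c β → Frontier s c′ β
  frontier-lower {s} {c} {c′} {β} c′≤c F = record
    { ones-above = λ v one → ≤-<-trans c′≤c (ones-above F v one)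
    ; unrefuted = λ Z R → unrefuted F (Z ↾≥ c) record
        { above = ↾≥-layer Z c
        ; small = ≤-trans (count²-mono (↾≥-⊆ Z c)) (small R)
        ; covered = covered′ Z R
        ; odd-sum = odd′ Z R } }
    where
    covered′ : ∀ Z → Refutation s c′ β Z →
               ∀ v → ∂ (Z ↾≥ c) v ≡ true → dom β v ≡ true ⊎ layerᵥ v ≤ c
    covered′ Z R v odd with layerᵥ v ≤? c
    ... | yes v≤c = inj₂ v≤c
    ... | no  v≰c with covered R v (trans (sym (∂-↾≥-high Z c v (≰⇒> v≰c))) odd)
    ...   | inj₁ v∈β  = inj₁ v∈β
    ...   | inj₂ v≤c′ = inj₂ (≤-trans v≤c′ c′≤c)
    odd′ : ∀ Z → Refutation s c′ β Z → ∂-sum (Z ↾≥ c) β ≡ true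
    odd′ Z R = trans (parity²-cong pointwise) (odd-sum R)
      where
      pointwise : ∀ v → ∂ (Z ↾≥ c) v ∧ isTrue (β v) ≡ ∂ Z v ∧ isTrue (β v)
      pointwise v with isTrue (β v) in one
      ... | true  = cong (_∧ true) (∂-↾≥-high Z c v (ones-above F v one))
      ... | false = trans (Boolₚ.∧-zeroʳ _) (sym (Boolₚ.∧-zeroʳ _))

  update-ones-above : ∀ {s c β β′ x b} → Update β x b β′ → c < layerᵥ x → Frontier s c β →
                      ∀ v → isTrue (β′ v) ≡ true → c < layerᵥ v
  update-ones-above u c<x F v one with update-ones u v one
  ... | inj₁ (refl , _) = c<x
  ... | inj₂ one′       = ones-above F v one′

  ∂-pebbled-or-zero : ∀ {s c β β′ Z} → Frontier s c β → Refutation s c β′ Z →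
                  ∀ v → ∂ Z v ≡ true → dom β′ v ≡ true ⊎ isTrue (β v) ≡ false
  ∂-pebbled-or-zero F R v odd with covered R v odd
  ... | inj₁ v∈β′ = inj₁ v∈β′
  ... | inj₂ v≤c  = inj₂ (zero-below F v v≤c)

  frontier-answer-low : ∀ {s c β β′ x} → Update β x false β′ → layerᵥ x ≤ c → Frontier s c β →
                        Frontier s c β′
  frontier-answer-low {s} {c} {β} {β′} {x} u x≤c F = record
    { ones-above = ones-above′
    ; unrefuted = λ Z R → unrefuted F Z
        (refutation-⊆ (λ _ p → p) R (covered′ Z R) (trans (∂-sum-agree Z (agree Z R)) (odd-sum R))) }
    where
    open Update u
    ones-above′ : ∀ v → isTrue (β′ v) ≡ true → c < layerᵥ v
    ones-above′ v one with update-ones u v one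
    ... | inj₂ one′ = ones-above F v one′
    covered′ : ∀ Z → Refutation s c β′ Z → ∀ v → ∂ Z v ≡ true → dom β v ≡ true ⊎ layerᵥ v ≤ c
    covered′ Z R v odd with covered R v odd
    ... | inj₂ v≤c  = inj₂ v≤c
    ... | inj₁ v∈β′ with update-dom u v v∈β′
    ...   | inj₁ refl = inj₂ x≤c
    ...   | inj₂ v∈β  = inj₁ v∈β
    agree : ∀ Z → Refutation s c β′ Z → ∀ v → ∂ Z v ≡ true → isTrue (β v) ≡ isTrue (β′ v)
    agree Z R v odd with x ≟V v
    ... | yes refl = trans (cong isTrue fresh) (sym (trans (cong isTrue sets) (isTrue-just false)))
    ... | no  x≢v  = sym (update-isTrue u v x≢v (∂-pebbled-or-zero F R v odd))

  localize : ∀ {s c β β′ x b Z} → Frontier s c β → Update β x b β′ → c + s < layerᵥ x →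
             Refutation s c β′ Z → ∃[ B ] Refutation s c β′ B × ∂ B ⊆ dom β′
  localize {c = c} {β} {β′} {x} {Z = Z} F u c+s<x R
    with empty-row Z c (layerᵥ x) (ℕₚ.≤-pred (toℕ<n (proj₁ x))) (≤-<-trans (+-monoʳ-≤ c (small R)) c+s<x)
  ... | row , c≤h , h<x , row-empty =
    B , refutation-⊆ (↾≥-⊆ Z h) R (λ v odd → inj₁ (∂B⊆dom v odd)) odd-B , ∂B⊆dom
    where
    h = toℕ row
    A B : W → Bool
    A = Z ↾< h
    B = Z ↾≥ h
    B-high : ∀ w → B w ≡ true → suc h ≤ layerʷ w
    B-high (i , j) Bw = ℕₚ.≤∧≢⇒< (↾≥-layer Z h (i , j) Bw) h≢i
      where
      h≢i : h ≢ toℕ i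
      h≢i h≡i with refl ← toℕ-injective h≡i =
        case trans (sym (row-empty j)) (↾≥-⊆ Z h (i , j) Bw) of λ ()
    ∂A-low : ∀ v → ∂ A v ≡ true → layerᵥ v ≤ h
    ∂A-low = ∂-below h (↾<-layer Z h)
    ∂B-high : ∀ v → ∂ B v ≡ true → suc h ≤ layerᵥ v
    ∂B-high = ∂-above (suc h) B-high
    ∂A⇒∂Z : ∀ v → ∂ A v ≡ true → ∂ Z v ≡ true
    ∂A⇒∂Z v odd =
      trans (∂-↾ Z h v) (cong₂ _xor_ odd (Boolₚ.¬-not (λ odd′ → <⇒≱ (∂B-high v odd′) (∂A-low v odd))))
    ∂B⇒∂Z : ∀ v → ∂ B v ≡ true → ∂ Z v ≡ true
    ∂B⇒∂Z v odd =
      trans (∂-↾ Z h v) (cong₂ _xor_ (Boolₚ.¬-not (λ odd′ → <⇒≱ (∂B-high v odd) (∂A-low v odd′))) odd)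
    x∉∂A : ∀ v → ∂ A v ≡ true → x ≢ v
    x∉∂A v odd refl = <⇒≱ h<x (∂A-low v odd)
    A-covered : ∀ v → ∂ A v ≡ true → dom β v ≡ true ⊎ layerᵥ v ≤ c
    A-covered v odd with covered R v (∂A⇒∂Z v odd)
    ... | inj₂ v≤c  = inj₂ v≤c
    ... | inj₁ v∈β′ with update-dom u v v∈β′
    ...   | inj₁ x≡v = ⊥-elim (x∉∂A v odd x≡v)
    ...   | inj₂ v∈β = inj₁ v∈β
    even-A : ∂-sum A β′ ≡ false
    even-A = trans (∂-sum-agree A λ v odd →
                      update-isTrue u v (x∉∂A v odd) (∂-pebbled-or-zero F R v (∂A⇒∂Z v odd)))
                   (Boolₚ.¬-not (λ odd → unrefuted F A (refutation-⊆ (↾<-⊆ Z h) R A-covered odd)))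
    odd-B : ∂-sum B β′ ≡ true
    odd-B = trans (sym (cong (_xor ∂-sum B β′) even-A)) (trans (sym (∂-sum-↾ Z h β′)) (odd-sum R))
    ∂B⊆dom : ∂ B ⊆ dom β′
    ∂B⊆dom v odd with covered R v (∂B⇒∂Z v odd)
    ... | inj₁ v∈β′ = v∈β′
    ... | inj₂ v≤c  = ⊥-elim (<⇒≱ (≤-trans (s≤s c≤h) (∂B-high v odd)) v≤c)

  refutation-drop : ∀ {s c β β′ x b B} → Update β x b β′ → Refutation s c β′ B → ∂ B ⊆ dom β′ →
                    ∂ B x ≡ false → Refutation s c β B
  refutation-drop {β = β} {x = x} {b} {B} u R ∂B⊆dom x∉∂B = refutation-⊆ (λ _ p → p) R covered′ odd′
    where
    covered′ : ∀ v → ∂ B v ≡ true → dom β v ≡ true ⊎ _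
    covered′ v odd with update-dom u v (∂B⊆dom v odd)
    ... | inj₁ refl = case trans (sym x∉∂B) odd of λ ()
    ... | inj₂ v∈β  = inj₁ v∈β
    odd′ : ∂-sum B β ≡ true
    odd′ = trans (∂-sum-update B u ∂B⊆dom) (cong₂ (λ o p → o xor (p ∧ b)) (odd-sum R) x∉∂B)

  refutation-merge : ∀ {s c β β₀ β₁ x B₀ B₁} → Update β x false β₀ → Update β x true β₁ →
                     Refutation s c β₀ B₀ → ∂ B₀ ⊆ dom β₀ →
                     Refutation s c β₁ B₁ → ∂ B₁ ⊆ dom β₁ →
                     ∂ B₀ x ≡ true → ∂ B₁ x ≡ true → count² B₀ + count² B₁ ≤ s →
                     Refutation s c β (λ w → B₀ w xor B₁ w)
  refutation-merge {c = c} {β} {x = x} {B₀} {B₁} u₀ u₁ R₀ ∂B₀⊆dom R₁ ∂B₁⊆dom x∈∂B₀ x∈∂B₁ fits =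
    record
    { above = above′
    ; small = ≤-trans (count²-mono xor⊆∨) (≤-trans (count²-∨ B₀ B₁) fits)
    ; covered = covered′
    ; odd-sum = trans (∂-sum-xor B₀ B₁ β) (cong₂ _xor_ odd₀ even₁) }
    where
    above′ : ∀ w → B₀ w xor B₁ w ≡ true → c ≤ layerʷ w
    above′ w p with xor-true {B₀ w} p
    ... | inj₁ B₀w = above R₀ w B₀w
    ... | inj₂ B₁w = above R₁ w B₁w
    xor⊆∨ : (λ w → B₀ w xor B₁ w) ⊆ (λ w → B₀ w ∨ B₁ w)
    xor⊆∨ w p with B₀ w
    ... | true  = refl
    ... | false = p
    old-dom : ∀ {b β′ B} → Update β x b β′ → ∂ B ⊆ dom β′ → ∀ v → x ≢ v → ∂ B v ≡ true →
              dom β v ≡ true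
    old-dom u ∂B⊆dom v x≢v odd with update-dom u v (∂B⊆dom v odd)
    ... | inj₁ x≡v = ⊥-elim (x≢v x≡v)
    ... | inj₂ v∈β = v∈β
    covered′ : ∀ v → ∂ (λ w → B₀ w xor B₁ w) v ≡ true → dom β v ≡ true ⊎ layerᵥ v ≤ c
    covered′ v odd with x ≟V v | xor-true (trans (sym (∂-xor B₀ B₁ v)) odd)
    ... | yes refl | _ = case trans (sym odd) (trans (∂-xor B₀ B₁ x) (cong₂ _xor_ x∈∂B₀ x∈∂B₁)) of λ ()
    ... | no  x≢v  | inj₁ odd₀ = inj₁ (old-dom u₀ ∂B₀⊆dom v x≢v odd₀)
    ... | no  x≢v  | inj₂ odd₁ = inj₁ (old-dom u₁ ∂B₁⊆dom v x≢v odd₁)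
    odd₀ : ∂-sum B₀ β ≡ true
    odd₀ = trans (∂-sum-update B₀ u₀ ∂B₀⊆dom)
                 (cong₂ (λ o p → o xor (p ∧ false)) (odd-sum R₀) x∈∂B₀)
    even₁ : ∂-sum B₁ β ≡ false
    even₁ = trans (∂-sum-update B₁ u₁ ∂B₁⊆dom)
                  (cong₂ (λ o p → o xor (p ∧ true)) (odd-sum R₁) x∈∂B₁)

  -- Verifier's strategy

  module _ {s : ℕ} (expands : ∀ B → 1 ≤ count² B → count² B ≤ s → count² B < ∣N*∣ E B) where

    pebbled-refutation-small : ∀ {c β B} → Refutation s c β B → ∂ B ⊆ dom β → count² B < count² (dom β)
    pebbled-refutation-small {B = B} R ∂B⊆dom =
      <-≤-trans (expands B (refutation-nonempty R) (small R))
                (≤-trans (count²-mono (single-neighbour⇒∂ B)) (count²-mono ∂B⊆dom))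

    frontier-pointAssign : ∀ {c} x → c + s < layerᵥ x → Frontier s c (pointAssign x)
    frontier-pointAssign {c} x c+s<x = record
      { ones-above = update-ones-above (pointAssign-update x) c<x (frontier-empty s c)
      ; unrefuted = λ Z R →
          let B , RB , ∂B⊆dom = localize (frontier-empty s c) (pointAssign-update x) c+s<x R
          in <⇒≱ (<-≤-trans (pebbled-refutation-small RB ∂B⊆dom) (count²-dom-pointAssign x))
                 (refutation-nonempty RB) }
      where
      c<x = ≤-<-trans (ℕₚ.m≤m+n c s) c+s<x

    module _ {k : ℕ} (1≤s : 1 ≤ s) (k+k≤2+s : k + k ≤ 2 + s) where

      not-both-refuted : ∀ {c β x β₀ β₁ Z₀ Z₁} → Frontier s c β →
                         Update β x false β₀ → Update β x true β₁ →
                         count² (dom β₀) ≤ k → count² (dom β₁) ≤ k →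
                         c + s < layerᵥ x → Refutation s c β₀ Z₀ → Refutation s c β₁ Z₁ → ⊥
      not-both-refuted {c} {x = x} {β₀} {β₁} F u₀ u₁ dom₀≤k dom₁≤k c+s<x R₀ R₁ =
        drop-or-merge (localize F u₀ c+s<x R₀) (localize F u₁ c+s<x R₁)
        where
        fit : ∀ {a b} → suc a ≤ k → suc b ≤ k → a + b ≤ s
        fit {a} {b} a<k b<k = ℕₚ.≤-pred (ℕₚ.≤-pred (≤-trans (≤-reflexive (sym (cong suc (+-suc a b))))
                                                              (≤-trans (+-mono-≤ a<k b<k) k+k≤2+s)))
        drop-or-merge : ∃[ B₀ ] Refutation s c β₀ B₀ × ∂ B₀ ⊆ dom β₀ →
                        ∃[ B₁ ] Refutation s c β₁ B₁ × ∂ B₁ ⊆ dom β₁ → ⊥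
        drop-or-merge (B₀ , RB₀ , full₀) (B₁ , RB₁ , full₁) with ∂ B₀ x in x₀ | ∂ B₁ x in x₁
        ... | false | _     = unrefuted F B₀ (refutation-drop u₀ RB₀ full₀ x₀)
        ... | true  | false = unrefuted F B₁ (refutation-drop u₁ RB₁ full₁ x₁)
        ... | true  | true  =
          unrefuted F _ (refutation-merge u₀ u₁ RB₀ full₀ RB₁ full₁ x₀ x₁ (fit B₀<k B₁<k))
          where
          B₀<k = <-≤-trans (pebbled-refutation-small RB₀ full₀) dom₀≤k
          B₁<k = <-≤-trans (pebbled-refutation-small RB₁ full₁) dom₁≤k

      answer-far : ∀ {c β x} {β′ : Bool → PAssign ℓ m} → Frontier s c β →
                   (∀ b → Update β x b (β′ b)) →
                   (∀ b → count² (dom (β′ b)) ≤ k) → c + s < layerᵥ x → ∃[ b ] Frontier s c (β′ b)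
      answer-far {c} {β′ = β′} F u dom≤k c+s<x with ∃refutation? s c (β′ false)
      ... | no  none      = false , record
        { ones-above = update-ones-above (u false) (≤-<-trans (m≤m+n c s) c+s<x) F
        ; unrefuted = λ Z R → none (Z , R) }
      ... | yes (Z₀ , R₀) = true , record
        { ones-above = update-ones-above (u true) (≤-<-trans (m≤m+n c s) c+s<x) F
        ; unrefuted = λ Z₁ R₁ → not-both-refuted F (u false) (u true) (dom≤k false) (dom≤k true) c+s<x R₀ R₁ }

      answer : ∀ {c β x} {β′ : Bool → PAssign ℓ m} → Frontier s c β → s ≤ c →
               (∀ b → Update β x b (β′ b)) → (∀ b → count² (dom (β′ b)) ≤ k) →
               ∃[ b ] ∃[ c′ ] c ≤ s + c′ × Frontier s c′ (β′ b)
      answer {c} {x = x} F s≤c u dom≤k with layerᵥ x ≤? c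
      ... | yes x≤c = false , c , ℕₚ.m≤n+m c s , frontier-answer-low (u false) x≤c F
      ... | no  x≰c =
        let c′ , c′≤c , c′+s<x , c≤s+c′ = lower-frontier s≤c (≰⇒> x≰c)
            b , F′ = answer-far (frontier-lower c′≤c F) u dom≤k c′+s<x
        in b , c′ , c≤s+c′ , F′

      verifier-wins : ∀ n {c β} → Frontier s c β → n * s ≤ c → SafeFor (suc n) k E β
      verifier-wins zero    F _ = frontier-consistent 1≤s F , λ _ _ _ _ _ → false , tt
      verifier-wins (suc n) {c} {β} F s+ns≤c = frontier-consistent 1≤s F , respond
        where
        respond : ∀ x X′ → β x ≡ nothing → (∀ v → X′ v ≡ true → β v ≢ nothing) →
                  count² X′ + 1 ≤ k →
                  Σ Bool λ b → SafeFor (suc n) k E (move β x X′ b)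
        respond x X′ fresh _ X′<k =
          let b , c′ , c≤s+c′ , F′ = answer F (ℕₚ.m+n≤o⇒m≤o s s+ns≤c) (λ b → move-update X′ b fresh)
                                            (λ b → ≤-trans (count²-dom-move β x X′ b) X′<k)
          in b , verifier-wins n F′ (ℕₚ.+-cancelˡ-≤ s _ _ (≤-trans s+ns≤c c≤s+c′))

-- Natural numbers as rationals

ℕ→ℚ≡mkℚ : ∀ n → ℕ→ℚ n ≡ mkℚ (+ n) 0 (coprime-sym (1-coprimeTo n))
ℕ→ℚ≡mkℚ n = ℚₚ.normalize-coprime (coprime-sym (1-coprimeTo n))

ℕ→ℚ-mono-≤ : ∀ {a b} → a ≤ b → ℕ→ℚ a ≤ℚ ℕ→ℚ b
ℕ→ℚ-mono-≤ {a} {b} a≤b rewrite ℕ→ℚ≡mkℚ a | ℕ→ℚ≡mkℚ b =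
  *≤* (subst₂ ℤ._≤_ (sym (ℤₚ.*-identityʳ (+ a))) (sym (ℤₚ.*-identityʳ (+ b))) (ℤ.+≤+ a≤b))

ℕ→ℚ-cancel-< : ∀ {a b} → ℕ→ℚ a <ℚ ℕ→ℚ b → a < b
ℕ→ℚ-cancel-< {a} {b} a<b rewrite ℕ→ℚ≡mkℚ a | ℕ→ℚ≡mkℚ b with a<b
... | *<* a<b′ = ℤₚ.drop‿+<+ (subst₂ ℤ._<_ (ℤₚ.*-identityʳ (+ a)) (ℤₚ.*-identityʳ (+ b)) a<b′)

α*n≤K⇒n<K : ∀ {α : ℚ} {n K} → 1ℚ <ℚ α → 1 ≤ n → α *ℚ ℕ→ℚ n ≤ℚ ℕ→ℚ K → n < K
α*n≤K⇒n<K {α} {suc n} 1<α _ αn≤K = ℕ→ℚ-cancel-< (ℚₚ.<-≤-trans n<αn αn≤K)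
  where
  instance
    n-positive : Positive (ℕ→ℚ (suc n))
    n-positive = subst Positive (sym (ℕ→ℚ≡mkℚ (suc n))) _
  n<αn : ℕ→ℚ (suc n) <ℚ α *ℚ ℕ→ℚ (suc n)
  n<αn = subst (_<ℚ α *ℚ ℕ→ℚ (suc n)) (ℚₚ.*-identityˡ (ℕ→ℚ (suc n)))
               (ℚₚ.*-monoˡ-<-pos (ℕ→ℚ (suc n)) 1<α)

sn-expander-expands : ∀ {ℓ m E α γ t} → 1ℚ <ℚ α → IsSNExpander ℓ m E α γ →
                      ℕ→ℚ t ≤ℚ γ *ℚ ℕ→ℚ m →
                      ∀ B → 1 ≤ count² B → count² B ≤ t → count² B < ∣N*∣ E B
sn-expander-expands 1<α expander t≤γm B 1≤B B≤t =
  α*n≤K⇒n<K 1<α 1≤B (expander B 1≤B (ℚₚ.≤-trans (ℕ→ℚ-mono-≤ B≤t) t≤γm))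

lemma5p16 : (α γ : ℚ) → 1ℚ <ℚ α → 0ℚ <ℚ γ → γ <ℚ 1ℚ →
    (ℓ m d k : ℕ) (E : Edges ℓ m) → IsLayered ℓ m E → IsSNExpander ℓ m E α γ →
    (∀ w → deg E w ≤ d) → d ≤ k → ℕ→ℚ (2 * k) ≤ℚ (γ *ℚ ℕ→ℚ m) →
    (i : Fin m) →
    (r : ℕ) → r * (2 * k) ≤ ℓ → ℓ < suc r * (2 * k) →
    SafeFor r k E (pointAssign (fromℕ ℓ , i))
lemma5p16 _ _ _ _ _ _ _ _ _ _ _ _ _ _ _ _ zero _ _ = _
lemma5p16 _ _ _ _ _ ℓ _ _ zero _ _ _ _ _ _ _ (suc r) _ ℓ<0 =
  ⊥-elim (ℕₚ.n≮0 (subst (ℓ <_) (ℕₚ.*-zeroʳ (suc (suc r))) ℓ<0))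
lemma5p16 _ γ 1<α _ _ ℓ _ _ k@(suc k′) E layered expander _ _ 2k≤γm i (suc r) r2k≤ℓ _ =
  verifier-wins expands 1≤s k+k≤2+s r (frontier-pointAssign expands x start) ℕₚ.≤-refl
  where
  open Layered E layered
  s = k′ + k
  x = (fromℕ ℓ , i)
  1≤s : 1 ≤ s
  1≤s = ℕₚ.≤-trans (s≤s z≤n) (ℕₚ.m≤n+m k k′)
  k+k≤2+s : k + k ≤ 2 + s
  k+k≤2+s = ℕₚ.n≤1+n (suc s)
  2k≡1+s : 2 * k ≡ suc s
  2k≡1+s = cong (λ t → suc (k′ + t)) (ℕₚ.+-identityʳ k)
  expands : ∀ B → 1 ≤ count² B → count² B ≤ s → count² B < ∣N*∣ E B
  expands = sn-expander-expands {E = E} {γ = γ} 1<α expander (ℚₚ.≤-trans (ℕ→ℚ-mono-≤ s≤2k) 2k≤γm)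
    where s≤2k = ℕₚ.≤-trans (ℕₚ.n≤1+n s) (ℕₚ.≤-reflexive (sym 2k≡1+s))
  start : r * s + s < layerᵥ x
  start = begin-strict
    r * s + s          ≡⟨ ℕₚ.+-comm (r * s) s ⟩
    s + r * s          <⟨ s≤s (ℕₚ.+-monoʳ-≤ s (ℕₚ.*-monoʳ-≤ r (ℕₚ.n≤1+n s))) ⟩
    suc r * suc s      ≡⟨ cong (suc r *_) (sym 2k≡1+s) ⟩
    suc r * (2 * k)    ≤⟨ r2k≤ℓ ⟩
    ℓ                  ≡⟨ sym (toℕ-fromℕ ℓ) ⟩
    layerᵥ x           ∎
    where open ℕₚ.≤-Reasoning
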